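{- Let $d=(A,P_A,Q_A)$ and $d'=(B,P_B,Q_B)$ be finite strict double posets with $|A|=|B|$, $|P_A|=|P_B|$ and $|Q_A|=|Q_B|$. Then $\mathrm{Epi}(d,d')\neq\emptyset$ if and only if $d\cong d'$.
   Context: A finite strict double poset is a triple $(A,P_A,Q_A)$ with $A$ finite and $P_A,Q_A\subseteq A\times A$ strict partial orders; morphisms are maps preserving both strict orders, and $\mathrm{Epi}(d,d')$ is the set of epimorphisms from $d$ to $d'$ in this category. -}

module Defs where

open import Data.Nat using (ℕ)
open import Data.Empty using (⊥)
open import Data.Bool using (Bool; true)
open import Data.Fin using (Fin)
open import Data.List using (List; length; filterᵇ; cartesianProduct)
open import Data.List.Base using (allFin)
open import Data.Product using (Σ; _×_; _,_; proj₁; proj₂)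
open import Relation.Binary.PropositionalEquality using (_≡_)

BRel : ℕ → Set
BRel n = Fin n → Fin n → Bool

record IsStrictPO {n : ℕ} (R : BRel n) : Set where
  field
    irrefl : ∀ x → R x x ≡ true → ⊥
    trans  : ∀ x y z → R x y ≡ true → R y z ≡ true → R x z ≡ true

record DPoset : Set where
  field
    size : ℕ
    P    : BRel size
    Q    : BRel size
    P-spo : IsStrictPO P
    Q-spo : IsStrictPO Q
open DPoset public

card : {n : ℕ} → BRel n → ℕ
card {n} R = length (filterᵇ (λ p → R (proj₁ p) (proj₂ p)) (cartesianProduct (allFin n) (allFin n)))

record Hom (d e : DPoset) : Set where
  field
    fun   : Fin (size d) → Fin (size e)
    pres-P : ∀ x y → P d x y ≡ true → P e (fun x) (fun y) ≡ true
    pres-Q : ∀ x y → Q d x y ≡ true → Q e (fun x) (fun y) ≡ true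
open Hom public

_≈ₕ_ : {d e : DPoset} → Hom d e → Hom d e → Set
f ≈ₕ g = ∀ x → fun f x ≡ fun g x

_∘ₕ_ : {c d e : DPoset} → Hom d e → Hom c d → Hom c e
fun (g ∘ₕ f) x = fun g (fun f x)
pres-P (g ∘ₕ f) x y p = pres-P g _ _ (pres-P f x y p)
pres-Q (g ∘ₕ f) x y q = pres-Q g _ _ (pres-Q f x y q)

idₕ : {d : DPoset} → Hom d d
fun idₕ x = x
pres-P idₕ x y p = p
pres-Q idₕ x y q = q

IsEpi : {d d' : DPoset} → Hom d d' → Set
IsEpi {d} {d'} f = ∀ (e : DPoset) (g h : Hom d' e) → (g ∘ₕ f) ≈ₕ (h ∘ₕ f) → g ≈ₕ h

EpiNonempty : DPoset → DPoset → Set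
EpiNonempty d d' = Σ (Hom d d') IsEpi

_≅_ : DPoset → DPoset → Set
d ≅ d' = Σ (Hom d d') λ f → Σ (Hom d' d) λ g → ((g ∘ₕ f) ≈ₕ idₕ) × ((f ∘ₕ g) ≈ₕ idₕ)

-- An epimorphism d → d' is surjective: otherwise the two embeddings of d' into the
-- double poset obtained by doubling a missed point would agree after it. Since |A| = |B|
-- it is then a bijection f, and f⁻¹ is monotone by counting: f maps the pairs of P_A
-- injectively into P_B, and |P_A| = |P_B| means it hits all of them (likewise for Q).
-- Conversely an isomorphism has a section, hence is epi.
module Submission where

open import Defs
open import Data.Product using (_×_)
open import Function.Bundles using (_⇔_)
open import Relation.Binary.PropositionalEquality using (_≡_)

open import Data.Bool using (Bool; true; false)
open import Data.Fin using (Fin; zero; suc; _≟_)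
open import Data.Fin.Permutation using (Permutation; permutation; _⟨$⟩ʳ_; _⟨$⟩ˡ_; inverseʳ)
open import Data.Fin.Properties using (any?; punchOut-injective; injective⇒≤; 0≢1+n)
open import Data.List using (length; filterᵇ; map; tabulate; cartesianProduct; _++_)
open import Data.List.Properties using (filter-++; length-++; map-tabulate)
open import Data.Nat as ℕ using (ℕ; _+_; _≤_; z≤n)
open import Data.Nat.Properties
  using (+-0-commutativeMonoid; ≤-refl; ≤-antisym; ≮⇒≥; +-mono-≤; +-mono-<-≤; +-cancelˡ-≡; <-irrefl; 1+n≰n)
open import Algebra.Properties.CommutativeMonoid.Sum +-0-commutativeMonoid
  using (sum; sum-permute; sum-cong-≗)
open import Data.Product using (Σ; ∃; _,_; proj₁; proj₂)
open import Data.Vec.Functional using (_∷_)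
open import Function.Base using (id; _∘_; _on_)
open import Function.Bundles using (mk⇔)
open import Function.Definitions using (Injective; StrictlySurjective; StrictlyInverseˡ; StrictlyInverseʳ)
open import Relation.Binary.PropositionalEquality
  using (refl; sym; trans; cong; cong₂; subst₂; _≢_; module ≡-Reasoning)
open import Relation.Nullary using (yes; no; ¬_; contradiction)
open import Relation.Nullary.Decidable using (T?; decidable-stable)

private
  variable
    A B : Set
    m n : ℕ

IsStrictPO-on : {R : BRel n} (π : Fin m → Fin n) → IsStrictPO R → IsStrictPO (R on π)
IsStrictPO-on π spo = record
  { irrefl = λ x → IsStrictPO.irrefl spo (π x)
  ; trans  = λ x y z → IsStrictPO.trans spo (π x) (π y) (π z)
  }

comap : (d : DPoset) → (Fin m → Fin (size d)) → DPoset
comap {m} d π = record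
  { size  = m
  ; P     = P d on π
  ; Q     = Q d on π
  ; P-spo = IsStrictPO-on π (P-spo d)
  ; Q-spo = IsStrictPO-on π (Q-spo d)
  }

section⇒Hom : (d : DPoset) (π : Fin m → Fin (size d)) (s : Fin (size d) → Fin m) →
              (∀ x → π (s x) ≡ x) → Hom d (comap d π)
section⇒Hom d π s π∘s = record
  { fun    = s
  ; pres-P = λ x y → subst₂ (λ u v → P d u v ≡ true) (sym (π∘s x)) (sym (π∘s y))
  ; pres-Q = λ x y → subst₂ (λ u v → Q d u v ≡ true) (sym (π∘s x)) (sym (π∘s y))
  }

sucExcept : Fin n → Fin n → Fin (1 + n)
sucExcept b x with x ≟ b
... | yes _ = zero
... | no  _ = suc x

sucExcept-section : (b : Fin n) → ∀ x → (b ∷ id) (sucExcept b x) ≡ x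
sucExcept-section b x with x ≟ b
... | yes x≡b = sym x≡b
... | no  _   = refl

sucExcept-self : (b : Fin n) → sucExcept b b ≡ zero
sucExcept-self b with b ≟ b
... | yes _   = refl
... | no  b≢b = contradiction refl b≢b

sucExcept-≢ : (b : Fin n) → ∀ {x} → x ≢ b → sucExcept b x ≡ suc x
sucExcept-≢ b {x} x≢b with x ≟ b
... | yes x≡b = contradiction x≡b x≢b
... | no  _   = refl

epi⇒surjective : {d d' : DPoset} (f : Hom d d') → IsEpi f → StrictlySurjective _≡_ (fun f)
epi⇒surjective {d' = d'} f epi b = decidable-stable (any? λ a → fun f a ≟ b) λ b∉im →
  0≢1+n (sym (trans (epi (comap d' (b ∷ id)) embed₁ embed₂ (agree b∉im) b) (sucExcept-self b)))
  where
  -- comap d' (b ∷ id) is d' with the point b doubled (as zero and suc b).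
  embed₁ embed₂ : Hom d' (comap d' (b ∷ id))
  embed₁ = section⇒Hom d' (b ∷ id) suc (λ _ → refl)
  embed₂ = section⇒Hom d' (b ∷ id) (sucExcept b) (sucExcept-section b)
  agree : ¬ (∃ λ a → fun f a ≡ b) → (embed₁ ∘ₕ f) ≈ₕ (embed₂ ∘ₕ f)
  agree b∉im a = sym (sucExcept-≢ b λ fa≡b → b∉im (a , fa≡b))

injective⇒surjective : {f : Fin n → Fin n} → Injective _≡_ _≡_ f → StrictlySurjective _≡_ f
injective⇒surjective {ℕ.suc n} {f} f-inj y = decidable-stable (any? λ x → f x ≟ y) λ y∉im →
  1+n≰n (injective⇒≤ (λ {x} {x'} eq → f-inj (punchOut-injective (avoids y∉im x) (avoids y∉im x') eq)))
  where
  avoids : ¬ (∃ λ x → f x ≡ y) → ∀ x → y ≢ f x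
  avoids y∉im x y≡fx = y∉im (x , sym y≡fx)

surjective⇒inverse : m ≡ n → (f : Fin m → Fin n) → StrictlySurjective _≡_ f →
                     Σ (Fin n → Fin m) λ g → StrictlyInverseˡ _≡_ f g × StrictlyInverseʳ _≡_ f g
surjective⇒inverse {m} refl f f-surj = g , f∘g , g∘f
  where
  g : Fin m → Fin m
  g = proj₁ ∘ f-surj
  f∘g : ∀ y → f (g y) ≡ y
  f∘g = proj₂ ∘ f-surj
  g-injective : Injective _≡_ _≡_ g
  g-injective {y} {y'} eq = trans (sym (f∘g y)) (trans (cong f eq) (f∘g y'))
  g∘f : ∀ x → g (f x) ≡ x
  g∘f x with y , refl ← injective⇒surjective {f = g} g-injective x = cong g (f∘g y)

sum-mono-≤ : {a c : Fin n → ℕ} → (∀ i → a i ≤ c i) → sum a ≤ sum c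
sum-mono-≤ {ℕ.zero}  _   = z≤n
sum-mono-≤ {ℕ.suc n} a≤c = +-mono-≤ (a≤c zero) (sum-mono-≤ (a≤c ∘ suc))

pointwise-≤∧sum-≡⇒≗ : {a c : Fin n → ℕ} → (∀ i → a i ≤ c i) → sum a ≡ sum c → ∀ i → a i ≡ c i
pointwise-≤∧sum-≡⇒≗ {ℕ.suc n} {a} {c} a≤c Σa≡Σc = pointwise
  where
  head : a zero ≡ c zero
  head = ≤-antisym (a≤c zero) (≮⇒≥ λ a₀<c₀ → <-irrefl Σa≡Σc (+-mono-<-≤ a₀<c₀ (sum-mono-≤ (a≤c ∘ suc))))
  tail : sum (a ∘ suc) ≡ sum (c ∘ suc)
  tail = +-cancelˡ-≡ (a zero) _ _ (trans Σa≡Σc (cong (_+ sum (c ∘ suc)) (sym head)))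
  pointwise : ∀ i → a i ≡ c i
  pointwise zero    = head
  pointwise (suc i) = pointwise-≤∧sum-≡⇒≗ (a≤c ∘ suc) tail i

indicator : Bool → ℕ
indicator false = 0
indicator true  = 1

indicator-mono : {a b : Bool} → (a ≡ true → b ≡ true) → indicator a ≤ indicator b
indicator-mono {false} _   = z≤n
indicator-mono {true}  a⇒b with a⇒b refl
... | refl = ≤-refl

indicator-injective : {a b : Bool} → indicator a ≡ indicator b → a ≡ b
indicator-injective {false} {false} _ = refl
indicator-injective {true}  {true}  _ = refl

length-filterᵇ-tabulate : (p : A → Bool) (h : Fin n → A) →
                          length (filterᵇ p (tabulate h)) ≡ sum (indicator ∘ p ∘ h)
length-filterᵇ-tabulate {n = ℕ.zero}  p h = refl
length-filterᵇ-tabulate {n = ℕ.suc n} p h with p (h zero)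
... | false = length-filterᵇ-tabulate p (h ∘ suc)
... | true  = cong ℕ.suc (length-filterᵇ-tabulate p (h ∘ suc))

length-filterᵇ-cartesianProduct : (p : A × B → Bool) (g : Fin m → A) (h : Fin n → B) →
  length (filterᵇ p (cartesianProduct (tabulate g) (tabulate h)))
    ≡ sum λ i → sum λ j → indicator (p (g i , h j))
length-filterᵇ-cartesianProduct {m = ℕ.zero}  p g h = refl
length-filterᵇ-cartesianProduct {m = ℕ.suc m} p g h = begin
  length (filterᵇ p (row ++ rows))
    ≡⟨ cong length (filter-++ (T? ∘ p) row rows) ⟩
  length (filterᵇ p row ++ filterᵇ p rows)
    ≡⟨ length-++ (filterᵇ p row) ⟩
  length (filterᵇ p row) + length (filterᵇ p rows)
    ≡⟨ cong₂ _+_ first-row (length-filterᵇ-cartesianProduct p (g ∘ suc) h) ⟩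
  (sum λ j → indicator (p (g zero , h j))) + (sum λ i → sum λ j → indicator (p (g (suc i) , h j)))
    ∎
  where
  open ≡-Reasoning
  row   = map (g zero ,_) (tabulate h)
  rows  = cartesianProduct (tabulate (g ∘ suc)) (tabulate h)
  first-row : length (filterᵇ p row) ≡ sum λ j → indicator (p (g zero , h j))
  first-row = trans (cong (length ∘ filterᵇ p) (map-tabulate h (g zero ,_)))
                    (length-filterᵇ-tabulate p ((g zero ,_) ∘ h))

card-sum : (R : BRel n) → card R ≡ sum λ x → sum λ y → indicator (R x y)
card-sum R = length-filterᵇ-cartesianProduct (λ p → R (proj₁ p) (proj₂ p)) id id

card-on-permutation : (π : Permutation m n) (R : BRel n) → card (R on (π ⟨$⟩ʳ_)) ≡ card R
card-on-permutation π R = begin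
  card (R on (π ⟨$⟩ʳ_))                                   ≡⟨ card-sum (R on (π ⟨$⟩ʳ_)) ⟩
  (sum λ x → sum λ y → indicator (R (π ⟨$⟩ʳ x) (π ⟨$⟩ʳ y))) ≡⟨ sum-permute (λ x → sum λ y → indicator (R x (π ⟨$⟩ʳ y))) π ⟨
  (sum λ x → sum λ y → indicator (R x (π ⟨$⟩ʳ y)))         ≡⟨ sum-cong-≗ (λ x → sum-permute (λ y → indicator (R x y)) π) ⟨
  (sum λ x → sum λ y → indicator (R x y))                  ≡⟨ card-sum R ⟨
  card R                                                    ∎
  where open ≡-Reasoning

_⊆_ : BRel n → BRel n → Set
R ⊆ S = ∀ x y → R x y ≡ true → S x y ≡ true

⊆∧card≡⇒⊇ : {R S : BRel n} → R ⊆ S → card R ≡ card S → S ⊆ R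
⊆∧card≡⇒⊇ {R = R} {S} R⊆S |R|≡|S| x y Sxy = trans (indicator-injective (entries x y)) Sxy
  where
  entry≤ : ∀ x y → indicator (R x y) ≤ indicator (S x y)
  entry≤ x y = indicator-mono (R⊆S x y)
  rows : ∀ x → (sum λ y → indicator (R x y)) ≡ (sum λ y → indicator (S x y))
  rows = pointwise-≤∧sum-≡⇒≗ (sum-mono-≤ ∘ entry≤) (trans (sym (card-sum R)) (trans |R|≡|S| (card-sum S)))
  entries : ∀ x y → indicator (R x y) ≡ indicator (S x y)
  entries x = pointwise-≤∧sum-≡⇒≗ (entry≤ x) (rows x)

card≡⇒reflects : (π : Permutation m n) {R : BRel m} {S : BRel n} → R ⊆ (S on (π ⟨$⟩ʳ_)) → card R ≡ card S →
                 ∀ u v → S u v ≡ true → R (π ⟨$⟩ˡ u) (π ⟨$⟩ˡ v) ≡ true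
card≡⇒reflects π {R} {S} R⊆S∘π |R|≡|S| u v Suv =
  ⊆∧card≡⇒⊇ R⊆S∘π (trans |R|≡|S| (sym (card-on-permutation π S))) (π ⟨$⟩ˡ u) (π ⟨$⟩ˡ v)
    (subst₂ (λ u v → S u v ≡ true) (sym (inverseʳ π)) (sym (inverseʳ π)) Suv)

bijectiveHom⇒≅ : (d d' : DPoset) (f : Hom d d') (g : Fin (size d') → Fin (size d)) →
                 StrictlyInverseˡ _≡_ (fun f) g → StrictlyInverseʳ _≡_ (fun f) g →
                 card (P d) ≡ card (P d') → card (Q d) ≡ card (Q d') → d ≅ d'
bijectiveHom⇒≅ d d' f g f∘g g∘f |P|≡ |Q|≡ = f , f⁻¹ , g∘f , f∘g
  where
  π = permutation (fun f) g f∘g g∘f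
  f⁻¹ : Hom d' d
  f⁻¹ = record
    { fun    = g
    ; pres-P = card≡⇒reflects π (pres-P f) |P|≡
    ; pres-Q = card≡⇒reflects π (pres-Q f) |Q|≡
    }

section⇒IsEpi : {d d' : DPoset} (f : Hom d d') (g : Hom d' d) → (f ∘ₕ g) ≈ₕ idₕ → IsEpi f
section⇒IsEpi f g f∘g≈id e h k h∘f≈k∘f y = begin
  fun h y                 ≡⟨ cong (fun h) (f∘g≈id y) ⟨
  fun h (fun f (fun g y)) ≡⟨ h∘f≈k∘f (fun g y) ⟩
  fun k (fun f (fun g y)) ≡⟨ cong (fun k) (f∘g≈id y) ⟩
  fun k y                 ∎
  where open ≡-Reasoning

lemmaB14 : (d d' : DPoset) → size d ≡ size d' → card (P d) ≡ card (P d') → card (Q d) ≡ card (Q d')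
    → (EpiNonempty d d' ⇔ (d ≅ d'))
lemmaB14 d d' |A|≡|B| |P|≡ |Q|≡ = mk⇔ epi⇒≅ ≅⇒epi
  where
  epi⇒≅ : EpiNonempty d d' → d ≅ d'
  epi⇒≅ (f , epi) with g , f∘g , g∘f ← surjective⇒inverse |A|≡|B| (fun f) (epi⇒surjective f epi)
    = bijectiveHom⇒≅ d d' f g f∘g g∘f |P|≡ |Q|≡
  ≅⇒epi : d ≅ d' → EpiNonempty d d'
  ≅⇒epi (f , g , _ , f∘g≈id) = f , section⇒IsEpi f g f∘g≈id
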